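{- Let $k\geq 2$ and $n\geq 7k^{2}$ be integers, and let $G$ be a graph of order $n$ with $e(G)>k(n-k)$ and minimum degree $\delta(G)\leq k-1$. Suppose $G$ has a vertex $u$ of degree $n-1$. If $G$ does not contain $P_{2k+3}$ as a subgraph, then there exists an induced subgraph $H$ of $G$ with at least $n-k^{2}$ vertices, with $\delta(H)\geq k$, and with $u\in V(H)$.
   Context: All graphs are finite and simple. $e(G)$ denotes the number of edges, $\delta(\cdot)$ the minimum degree, and $P_l$ the path on $l$ vertices. -}

module Defs where

open import Data.Nat using (ℕ; zero; suc; _+_; _<_)
open import Data.Bool using (Bool; true; false; if_then_else_; _∧_)
open import Data.Fin using (Fin; toℕ; inject₁) renaming (zero to fzero; suc to fsuc)
open import Data.Fin.Subset using (Subset; _∈_; ∣_∣)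
open import Data.Product using (Σ; ∃; _×_)
open import Function.Definitions using (Injective)
open import Relation.Binary.PropositionalEquality using (_≡_)
open import Relation.Nullary using (¬_)
open import Relation.Nullary.Decidable using (⌊_⌋)
open import Data.Nat using (_<?_)

record Graph (n : ℕ) : Set where
  field
    adj   : Fin n → Fin n → Bool
    sym   : ∀ u v → adj u v ≡ adj v u
    irrefl : ∀ v → adj v v ≡ false
open Graph public

sumFin : ∀ {n} → (Fin n → ℕ) → ℕ
sumFin {zero}  f = 0
sumFin {suc n} f = f fzero + sumFin (λ i → f (fsuc i))

countFin : ∀ {n} → (Fin n → Bool) → ℕ
countFin p = sumFin (λ i → if p i then 1 else 0)

deg : ∀ {n} → Graph n → Fin n → ℕ
deg G v = countFin (adj G v)

edges : ∀ {n} → Graph n → ℕ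
edges G = sumFin (λ u → countFin (λ v → ⌊ toℕ u <? toℕ v ⌋ ∧ adj G u v))

-- G contains the path P_l (on l vertices) as a (not necessarily induced) subgraph:
-- an injective vertex map of Fin l whose consecutive images are adjacent.
ContainsPath : ∀ {n} → Graph n → ℕ → Set
ContainsPath {n} G zero = Σ (Fin 0 → Fin n) Injective′
  where Injective′ : (Fin 0 → Fin n) → Set
        Injective′ f = Injective _≡_ _≡_ f
ContainsPath {n} G (suc l) =
  Σ (Fin (suc l) → Fin n) λ f →
    Injective _≡_ _≡_ f × (∀ (i : Fin l) → adj G (f (inject₁ i)) (f (fsuc i)) ≡ true)

degIn : ∀ {n} → Graph n → Subset n → Fin n → ℕ
degIn G S v = countFin (λ w → adj G v w ∧ Data.Vec.lookup S w)
  where import Data.Vec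

-- Peel G from the full vertex set, repeatedly deleting a vertex other than u of degree at most k − 1
-- in what remains. If this stops within k² steps, the remainder induces the required subgraph: u keeps
-- degree |remainder| − 1 ≥ k. Otherwise, after k² + 1 deletions of at most k − 1 edges each, the
-- remaining r = n − k² − 1 vertices still span at least kr + 2 edges. Peeling these with threshold k
-- keeps the surplus, leaving a set F with at least k|F| + 2 edges, hence |F| ≥ 2k + 2, of minimum
-- degree at least k + 1. A Dirac–Pósa argument in F then builds a path on 2k + 3 vertices: a path
-- whose ends have all their F-neighbours on it closes into a cycle through u, which is reopened at u
-- and continued through u's edge to any new vertex, the last one taken outside F.

module Submission where

open import Defs renaming (sym to adj-sym; irrefl to adj-irrefl)
open import Data.Nat using (ℕ; zero; suc; _≤_; _<_; _+_; _*_; _∸_; z≤n; s≤s; z<s; _<?_; _≤?_)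
open import Data.Nat.Properties
open import Data.Nat.Tactic.RingSolver using (solve-∀)
open import Data.Bool using (Bool; true; false; _∧_; not; if_then_else_)
open import Data.Bool.Properties using (∧-identityʳ; ∧-zeroʳ; ¬-not) renaming (_≟_ to _≟ᵇ_)
open import Data.Fin using (Fin; toℕ; inject₁) renaming (zero to fzero; suc to fsuc)
open import Data.Fin.Properties using (any?) renaming (_≟_ to _≟ᶠ_)
open import Data.Fin.Subset using (Subset; _∈_; ∣_∣)
open import Data.Vec using (tabulate)
open import Data.Vec.Properties using (lookup∘tabulate; []=⇒lookup; lookup⇒[]=)
open import Data.Product using (Σ; _×_; _,_; proj₁; proj₂)
open import Data.Sum using (_⊎_; inj₁; inj₂; map₁)
open import Data.Unit using (⊤; tt)
open import Data.List using (List; []; _∷_; _++_; [_]; length; lookup; _ʳ++_)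
open import Data.List.Properties using (++-assoc; length-++; ʳ++-defn)
open import Data.List.Relation.Unary.Linked using (Linked; []; [-]; _∷_)
import Data.List.Relation.Unary.Linked as Linked
open import Data.List.Relation.Unary.Any using (here; there)
open import Data.List.Relation.Unary.All using (All; []; _∷_)
import Data.List.Relation.Unary.All as All
open import Data.List.Relation.Unary.All.Properties using (¬Any⇒All¬) renaming (++⁺ to All-++⁺)
open import Data.List.Relation.Unary.Unique.Propositional using (Unique; []; _∷_)
open import Data.List.Membership.Propositional using () renaming (_∈_ to _∈ˡ_; _∉_ to _∉ˡ_)
open import Data.List.Membership.Propositional.Properties using (∈-∃++; ∈-lookup)
open import Data.List.Relation.Binary.Permutation.Propositional
  using (_↭_; ↭-sym; ↭-trans; ↭-reflexive; ↭⇒↭ₛ; prep)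
open import Data.List.Relation.Binary.Permutation.Propositional.Properties
  using (++-comm; shift; ↭-reverse; ++⁺ʳ; ∈-resp-↭; ↭-length; All-resp-↭)
import Data.List.Relation.Binary.Permutation.Setoid.Properties as Permutationₛ
open import Function using (_∘_; case_of_)
open import Relation.Nullary using (¬_; does; yes; no; ¬?; _×-dec_; contradiction)
open import Relation.Nullary.Decidable using (⌊_⌋; ⌊⌋-map′; dec-true; dec-false; decidable-stable)
open import Relation.Binary.PropositionalEquality
  using (_≡_; _≢_; refl; sym; trans; cong; cong₂; subst; subst₂; setoid; ≢-sym; module ≡-Reasoning)

VertexSet : ℕ → Set
VertexSet n = Fin n → Bool

_⊆_ : ∀ {n} → VertexSet n → VertexSet n → Set
P ⊆ Q = ∀ i → P i ≡ true → Q i ≡ true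

𝟙 : Bool → ℕ
𝟙 b = if b then 1 else 0

𝟙-mono : ∀ {a b} → (a ≡ true → b ≡ true) → 𝟙 a ≤ 𝟙 b
𝟙-mono {false} _ = z≤n
𝟙-mono {true}  h rewrite h refl = ≤-refl

true≢false : true ≢ false
true≢false ()

sumFin-cong : ∀ {n} {f g : Fin n → ℕ} → (∀ i → f i ≡ g i) → sumFin f ≡ sumFin g
sumFin-cong {zero}  h = refl
sumFin-cong {suc n} h = cong₂ _+_ (h fzero) (sumFin-cong (h ∘ fsuc))

sumFin-mono : ∀ {n} {f g : Fin n → ℕ} → (∀ i → f i ≤ g i) → sumFin f ≤ sumFin g
sumFin-mono {zero}  h = z≤n
sumFin-mono {suc n} h = +-mono-≤ (h fzero) (sumFin-mono (h ∘ fsuc))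

countFin-cong : ∀ {n} {P Q : VertexSet n} → (∀ i → P i ≡ Q i) → countFin P ≡ countFin Q
countFin-cong h = sumFin-cong (cong 𝟙 ∘ h)

countFin-mono : ∀ {n} {P Q : VertexSet n} → P ⊆ Q → countFin P ≤ countFin Q
countFin-mono h = sumFin-mono (𝟙-mono ∘ h)

countFin-empty : ∀ {n} (P : VertexSet n) → (∀ i → P i ≡ false) → countFin P ≡ 0
countFin-empty {zero}  P h = refl
countFin-empty {suc n} P h rewrite h fzero = countFin-empty (P ∘ fsuc) (h ∘ fsuc)

countFin-full : ∀ {n} (P : VertexSet n) → (∀ i → P i ≡ true) → countFin P ≡ n
countFin-full {zero}  P h = refl
countFin-full {suc n} P h rewrite h fzero = cong suc (countFin-full (P ∘ fsuc) (h ∘ fsuc))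

countFin<n⇒∃-false : ∀ {n} (P : VertexSet n) → countFin P < n → Σ (Fin n) λ i → P i ≡ false
countFin<n⇒∃-false {suc n} P h with P fzero in e
... | false = fzero , e
... | true with countFin<n⇒∃-false (P ∘ fsuc) (≤-pred h)
...   | i , q = fsuc i , q

⊆-countFin-≥⇒⊇ : ∀ {n} {P Q : VertexSet n} → P ⊆ Q → countFin Q ≤ countFin P → Q ⊆ P
⊆-countFin-≥⇒⊇ {suc n} {P} {Q} P⊆Q = go (P fzero) (Q fzero) refl refl
  where
  go : ∀ p q → P fzero ≡ p → Q fzero ≡ q →
       𝟙 q + countFin (Q ∘ fsuc) ≤ 𝟙 p + countFin (P ∘ fsuc) → Q ⊆ P
  go true  true  P0 Q0 le fzero    _  = P0
  go true  true  P0 Q0 le (fsuc i) Qi = ⊆-countFin-≥⇒⊇ (P⊆Q ∘ fsuc) (≤-pred le) i Qi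
  go false false P0 Q0 le (fsuc i) Qi = ⊆-countFin-≥⇒⊇ (P⊆Q ∘ fsuc) le i Qi
  go false false P0 Q0 le fzero    Qi = contradiction (trans (sym Qi) Q0) true≢false
  go false true  P0 Q0 le i Qi = contradiction le (<⇒≱ (s≤s (countFin-mono (P⊆Q ∘ fsuc))))
  go true  false P0 Q0 le i Qi = contradiction (trans (sym (P⊆Q fzero P0)) Q0) true≢false

_∖_ : ∀ {n} → VertexSet n → Fin n → VertexSet n
(P ∖ v) z = P z ∧ not (does (z ≟ᶠ v))

∖-⊆ : ∀ {n} (P : VertexSet n) v → (P ∖ v) ⊆ P
∖-⊆ P v z h with P z
... | true  = refl
... | false = h

∖-≢ : ∀ {n} (P : VertexSet n) v z → (P ∖ v) z ≡ true → z ≢ v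
∖-≢ P v z h refl rewrite dec-true (v ≟ᶠ v) refl | ∧-zeroʳ (P v) = true≢false (sym h)

∖-intro : ∀ {n} (P : VertexSet n) v z → P z ≡ true → z ≢ v → (P ∖ v) z ≡ true
∖-intro P v z Pz z≢v rewrite Pz | dec-false (z ≟ᶠ v) z≢v = refl

∖-suc : ∀ {n} (P : VertexSet (suc n)) v i → (P ∖ fsuc v) (fsuc i) ≡ ((P ∘ fsuc) ∖ v) i
∖-suc P v i with i ≟ᶠ v
... | yes _ = refl
... | no  _ = refl

countFin-∖ : ∀ {n} (P : VertexSet n) v → countFin P ≡ 𝟙 (P v) + countFin (P ∖ v)
countFin-∖ {suc n} P fzero = cong (𝟙 (P fzero) +_)
  (cong₂ _+_ (cong 𝟙 (sym (∧-zeroʳ (P fzero)))) (countFin-cong λ i → sym (∧-identityʳ (P (fsuc i)))))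
countFin-∖ {suc n} P (fsuc v) = begin
  𝟙 (P fzero) + countFin (P ∘ fsuc)
    ≡⟨ cong (𝟙 (P fzero) +_) (countFin-∖ (P ∘ fsuc) v) ⟩
  𝟙 (P fzero) + (𝟙 (P (fsuc v)) + countFin ((P ∘ fsuc) ∖ v))
    ≡⟨ +-left-comm (𝟙 (P fzero)) (𝟙 (P (fsuc v))) _ ⟩
  𝟙 (P (fsuc v)) + (𝟙 (P fzero) + countFin ((P ∘ fsuc) ∖ v))
    ≡⟨ cong (𝟙 (P (fsuc v)) +_) (cong₂ _+_ (cong 𝟙 (sym (∧-identityʳ (P fzero)))) (countFin-cong (sym ∘ ∖-suc P v))) ⟩
  𝟙 (P (fsuc v)) + countFin (P ∖ fsuc v) ∎
  where
  open ≡-Reasoning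
  +-left-comm : ∀ a b c → a + (b + c) ≡ b + (a + c)
  +-left-comm = solve-∀

dropFirst : ∀ {n} → Graph (suc n) → Graph n
dropFirst G = record
  { adj    = λ i j → adj G (fsuc i) (fsuc j)
  ; sym    = λ i j → adj-sym G (fsuc i) (fsuc j)
  ; irrefl = adj-irrefl G ∘ fsuc
  }

-- The order used by edges G, by recursion on Fin so that edgesOn unfolds along dropFirst.
_<ᵇ_ : ∀ {n} → Fin n → Fin n → Bool
fzero  <ᵇ fsuc _ = true
fsuc a <ᵇ fsuc b = a <ᵇ b
_      <ᵇ fzero  = false

toℕ-<?≡<ᵇ : ∀ {n} (a b : Fin n) → ⌊ toℕ a <? toℕ b ⌋ ≡ a <ᵇ b
toℕ-<?≡<ᵇ fzero    fzero    = refl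
toℕ-<?≡<ᵇ fzero    (fsuc b) = refl
toℕ-<?≡<ᵇ (fsuc a) fzero    = refl
toℕ-<?≡<ᵇ (fsuc a) (fsuc b) = trans (suc-<? (toℕ a) (toℕ b)) (toℕ-<?≡<ᵇ a b)
  where
  suc-<? : ∀ x y → ⌊ suc x <? suc y ⌋ ≡ ⌊ x <? y ⌋
  suc-<? x y = trans (⌊⌋-map′ _ _ _) (sym (⌊⌋-map′ _ _ _))

Dominating : ∀ {n} → Graph n → Fin n → Set
Dominating G u = ∀ w → w ≢ u → adj G u w ≡ true

degOn : ∀ {n} → Graph n → VertexSet n → Fin n → ℕ
degOn G T v = countFin (λ w → adj G v w ∧ T w)

edgesOn : ∀ {n} → Graph n → VertexSet n → ℕ
edgesOn G T = sumFin (λ a → countFin (λ b → a <ᵇ b ∧ adj G a b ∧ T a ∧ T b))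

edges≡edgesOn-full : ∀ {n} (G : Graph n) → edges G ≡ edgesOn G (λ _ → true)
edges≡edgesOn-full G = sumFin-cong λ a → countFin-cong λ b →
  cong₂ _∧_ (toℕ-<?≡<ᵇ a b) (sym (∧-identityʳ (adj G a b)))

edgesOn-cong : ∀ {n} (G : Graph n) {T U : VertexSet n} → (∀ i → T i ≡ U i) → edgesOn G T ≡ edgesOn G U
edgesOn-cong G h = sumFin-cong λ a → countFin-cong λ b →
  cong₂ (λ x y → a <ᵇ b ∧ adj G a b ∧ x ∧ y) (h a) (h b)

choose2 : ℕ → ℕ
choose2 zero    = 0
choose2 (suc m) = m + choose2 m

choose2-double : ∀ m → choose2 m * 2 + m ≡ m * m
choose2-double zero    = refl
choose2-double (suc m) = begin
  (m + choose2 m) * 2 + suc m         ≡⟨ regroup m (choose2 m) ⟩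
  (choose2 m * 2 + m) + m + suc m     ≡⟨ cong (λ x → x + m + suc m) (choose2-double m) ⟩
  m * m + m + suc m                   ≡⟨ square-suc m ⟩
  suc m * suc m                       ∎
  where
  open ≡-Reasoning
  regroup : ∀ m c → (m + c) * 2 + suc m ≡ (c * 2 + m) + m + suc m
  regroup = solve-∀
  square-suc : ∀ m → m * m + m + suc m ≡ suc m * suc m
  square-suc = solve-∀

edgesAt0 : ∀ {n} → Graph (suc n) → VertexSet (suc n) → ℕ
edgesAt0 G T = countFin (λ b → adj G fzero (fsuc b) ∧ T fzero ∧ T (fsuc b))

edgesOn≤choose2 : ∀ {n} (G : Graph n) T → edgesOn G T ≤ choose2 (countFin T)
edgesOn≤choose2 {zero}  G T = z≤n
edgesOn≤choose2 {suc n} G T with T fzero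
... | true  = +-mono-≤ (countFin-mono λ b → lem (adj G fzero (fsuc b)) (T (fsuc b)))
                       (edgesOn≤choose2 (dropFirst G) (T ∘ fsuc))
  where
  lem : ∀ x y → (x ∧ true ∧ y) ≡ true → y ≡ true
  lem true  y h = h
  lem false y ()
... | false = subst (_≤ choose2 (countFin (T ∘ fsuc)))
                    (cong (_+ edgesOn (dropFirst G) (T ∘ fsuc))
                          (sym (countFin-empty _ λ b → lem (adj G fzero (fsuc b)) (T (fsuc b)))))
                    (edgesOn≤choose2 (dropFirst G) (T ∘ fsuc))
  where
  lem : ∀ x y → (x ∧ false ∧ y) ≡ false
  lem true  y = refl
  lem false y = refl

edgesAt0≤degOn : ∀ {n} (G : Graph (suc n)) T → edgesAt0 G T ≤ degOn G T fzero
edgesAt0≤degOn G T = ≤-trans (countFin-mono λ b → lem (adj G fzero (fsuc b)) (T fzero) (T (fsuc b)))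
                             (m≤n+m _ (𝟙 (adj G fzero fzero ∧ T fzero)))
  where
  lem : ∀ x y z → (x ∧ y ∧ z) ≡ true → (x ∧ z) ≡ true
  lem true true z h = h

edgesOn-∖ : ∀ {n} (G : Graph n) T v → edgesOn G T ≤ edgesOn G (T ∖ v) + degOn G T v
edgesOn-∖ {suc n} G T fzero = begin
  edgesAt0 G T + E′ (T ∘ fsuc)
    ≤⟨ +-monoˡ-≤ _ (edgesAt0≤degOn G T) ⟩
  degOn G T fzero + E′ (T ∘ fsuc)
    ≡⟨ cong (degOn G T fzero +_) (edgesOn-cong (dropFirst G) λ i → sym (∧-identityʳ (T (fsuc i)))) ⟩
  degOn G T fzero + E′ ((T ∖ fzero) ∘ fsuc)
    ≤⟨ m≤n+m _ (edgesAt0 G (T ∖ fzero)) ⟩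
  edgesAt0 G (T ∖ fzero) + (degOn G T fzero + E′ ((T ∖ fzero) ∘ fsuc))
    ≡⟨ regroup (edgesAt0 G (T ∖ fzero)) (degOn G T fzero) _ ⟩
  (edgesAt0 G (T ∖ fzero) + E′ ((T ∖ fzero) ∘ fsuc)) + degOn G T fzero ∎
  where
  open ≤-Reasoning
  E′ = edgesOn (dropFirst G)
  regroup : ∀ a b c → a + (b + c) ≡ (a + c) + b
  regroup = solve-∀
-- Of the edges at vertex 0 only {0, v} is lost, and degOn G T v counts it in its first summand v0.
edgesOn-∖ {suc n} G T (fsuc v) = begin
  edgesAt0 G T + E′ (T ∘ fsuc)
    ≡⟨ cong (_+ E′ (T ∘ fsuc)) (countFin-∖ P v) ⟩
  (𝟙 (P v) + countFin (P ∖ v)) + E′ (T ∘ fsuc)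
    ≡⟨ cong (λ z → (𝟙 (P v) + z) + E′ (T ∘ fsuc)) (countFin-cong P∖v≡) ⟩
  (𝟙 (P v) + edgesAt0 G (T ∖ fsuc v)) + E′ (T ∘ fsuc)
    ≤⟨ +-monoʳ-≤ _ (edgesOn-∖ (dropFirst G) (T ∘ fsuc) v) ⟩
  (𝟙 (P v) + edgesAt0 G (T ∖ fsuc v)) + (E′ ((T ∘ fsuc) ∖ v) + degOn (dropFirst G) (T ∘ fsuc) v)
    ≤⟨ +-monoˡ-≤ _ (+-monoˡ-≤ _ (𝟙-mono Pv⇒v0)) ⟩
  (v0 + edgesAt0 G (T ∖ fsuc v)) + (E′ ((T ∘ fsuc) ∖ v) + degOn (dropFirst G) (T ∘ fsuc) v)
    ≡⟨ regroup v0 (edgesAt0 G (T ∖ fsuc v)) _ _ ⟩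
  (edgesAt0 G (T ∖ fsuc v) + E′ ((T ∘ fsuc) ∖ v)) + (v0 + degOn (dropFirst G) (T ∘ fsuc) v)
    ≡⟨ cong (λ z → (edgesAt0 G (T ∖ fsuc v) + z) + (v0 + degOn (dropFirst G) (T ∘ fsuc) v)) (edgesOn-cong (dropFirst G) (sym ∘ ∖-suc T v)) ⟩
  (edgesAt0 G (T ∖ fsuc v) + E′ ((T ∖ fsuc v) ∘ fsuc)) + (v0 + degOn (dropFirst G) (T ∘ fsuc) v) ∎
  where
  open ≤-Reasoning
  E′ = edgesOn (dropFirst G)
  P : VertexSet n
  P b = adj G fzero (fsuc b) ∧ T fzero ∧ T (fsuc b)
  v0 = 𝟙 (adj G (fsuc v) fzero ∧ T fzero)
  P∖v≡ : ∀ b → (P ∖ v) b ≡ adj G fzero (fsuc b) ∧ (T ∖ fsuc v) fzero ∧ (T ∖ fsuc v) (fsuc b)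
  P∖v≡ b = trans (lem (adj G fzero (fsuc b)) (T fzero) (T (fsuc b)) _)
                 (cong (λ z → adj G fzero (fsuc b) ∧ (T fzero ∧ true) ∧ z) (sym (∖-suc T v b)))
    where
    lem : ∀ x y z e → ((x ∧ y ∧ z) ∧ e) ≡ (x ∧ (y ∧ true) ∧ (z ∧ e))
    lem true true  z e = refl
    lem true false z e = refl
    lem false y    z e = refl
  Pv⇒v0 : P v ≡ true → (adj G (fsuc v) fzero ∧ T fzero) ≡ true
  Pv⇒v0 h rewrite adj-sym G (fsuc v) fzero with adj G fzero (fsuc v) | T fzero
  ... | true | true = refl
  regroup : ∀ a b c d → (a + b) + (c + d) ≡ (b + c) + (a + d)
  regroup = solve-∀

-- The outcome of deleting from T, at most fuel times, a vertex other than u of degree at most c.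
record Peeling {n} (G : Graph n) (u : Fin n) (c fuel : ℕ) (T : VertexSet n) : Set where
  field
    core         : VertexSet n
    removed      : ℕ
    u∈core       : core u ≡ true
    countFin-T   : countFin T ≡ countFin core + removed
    edgesOn-T    : edgesOn G T ≤ edgesOn G core + c * removed
    removed≤fuel : removed ≤ fuel
    finished     : removed ≡ fuel ⊎ (∀ v → core v ≡ true → v ≢ u → c < degOn G core v)

unpeeled : ∀ {n} {G : Graph n} {u c fuel T} → T u ≡ true →
           0 ≡ fuel ⊎ (∀ v → T v ≡ true → v ≢ u → c < degOn G T v) → Peeling G u c fuel T
unpeeled {G = G} {c = c} {T = T} Tu fin = record
  { core = T ; removed = 0 ; u∈core = Tu
  ; countFin-T = sym (+-identityʳ _)
  ; edgesOn-T = ≤-reflexive (sym (trans (cong (edgesOn G T +_) (*-zeroʳ c)) (+-identityʳ _)))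
  ; removed≤fuel = z≤n ; finished = fin }

peel : ∀ {n} (G : Graph n) u c fuel (T : VertexSet n) → T u ≡ true → Peeling G u c fuel T
peel G u c zero T Tu = unpeeled Tu (inj₁ refl)
peel G u c (suc fuel) T Tu with any? (λ v → ((T ∖ u) v ≟ᵇ true) ×-dec (degOn G T v ≤? c))
... | yes (v , v∈T∖u , deg≤c) = record
    { core = core ; removed = suc removed ; u∈core = u∈core
    ; countFin-T = begin-equality
        countFin T                              ≡⟨ countFin-∖ T v ⟩
        𝟙 (T v) + countFin (T ∖ v)              ≡⟨ cong (λ b → 𝟙 b + countFin (T ∖ v)) (∖-⊆ T u v v∈T∖u) ⟩
        suc (countFin (T ∖ v))                  ≡⟨ cong suc countFin-T ⟩
        suc (countFin core + removed)           ≡⟨ +-suc _ removed ⟨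
        countFin core + suc removed             ∎
    ; edgesOn-T = begin
        edgesOn G T                             ≤⟨ edgesOn-∖ G T v ⟩
        edgesOn G (T ∖ v) + degOn G T v         ≤⟨ +-mono-≤ edgesOn-T deg≤c ⟩
        edgesOn G core + c * removed + c        ≡⟨ regroup (edgesOn G core) c removed ⟩
        edgesOn G core + c * suc removed        ∎
    ; removed≤fuel = s≤s removed≤fuel
    ; finished = map₁ (cong suc) finished }
  where
  open ≤-Reasoning
  u∈T∖v = ∖-intro T v u Tu (≢-sym (∖-≢ T u v v∈T∖u))
  open Peeling (peel G u c fuel (T ∖ v) u∈T∖v)
  regroup : ∀ e c s → e + c * s + c ≡ e + c * suc s
  regroup = solve-∀
... | no ∄v = unpeeled Tu (inj₂ λ v Tv v≢u → ≰⇒> λ deg≤c → ∄v (v , ∖-intro T u v Tv v≢u , deg≤c))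

deg≡n∸1⇒Dominating : ∀ {n} (G : Graph n) u → deg G u ≡ n ∸ 1 → Dominating G u
deg≡n∸1⇒Dominating {n} G u deg-u w w≢u =
  ⊆-countFin-≥⇒⊇ N⊆V∖u |V∖u|≤deg w (∖-intro V u w refl w≢u)
  where
  V : VertexSet n
  V _ = true
  N⊆V∖u : adj G u ⊆ (V ∖ u)
  N⊆V∖u z u~z = ∖-intro V u z refl λ { refl → true≢false (trans (sym u~z) (adj-irrefl G u)) }
  |V∖u|≤deg : countFin (V ∖ u) ≤ deg G u
  |V∖u|≤deg = ≤-reflexive (trans (cong (_∸ 1) (trans (sym (countFin-∖ V u)) (countFin-full V λ _ → refl)))
                                 (sym deg-u))

countFin≤1+degOn : ∀ {n} (G : Graph n) u → Dominating G u → ∀ T → T u ≡ true → countFin T ≤ suc (degOn G T u)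
countFin≤1+degOn G u dom T Tu = begin
  countFin T                  ≡⟨ countFin-∖ T u ⟩
  𝟙 (T u) + countFin (T ∖ u)  ≡⟨ cong (λ b → 𝟙 b + countFin (T ∖ u)) Tu ⟩
  suc (countFin (T ∖ u))      ≤⟨ s≤s (countFin-mono T∖u⊆N) ⟩
  suc (degOn G T u)           ∎
  where
  open ≤-Reasoning
  T∖u⊆N : (T ∖ u) ⊆ (λ w → adj G u w ∧ T w)
  T∖u⊆N w h rewrite dom w (∖-≢ T u w h) = ∖-⊆ T u w h

Peeling-δ : ∀ {n} {G : Graph n} {u c fuel T} → Dominating G u → (P : Peeling G u c fuel T) →
            Peeling.removed P < fuel → suc c < countFin (Peeling.core P) →
            ∀ v → Peeling.core P v ≡ true → suc c ≤ degOn G (Peeling.core P) v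
Peeling-δ {G = G} {u = u} dom P short large v v∈core with finished | v ≟ᶠ u
  where open Peeling P
... | inj₁ exhausted | _       = contradiction exhausted (<⇒≢ short)
... | inj₂ δ         | no v≢u  = δ v v∈core v≢u
... | inj₂ _         | yes refl =
  ≤-pred (≤-trans large (countFin≤1+degOn G u dom (Peeling.core P) (Peeling.u∈core P)))

module _ {X : Set} where

  data Last : List X → X → Set where
    [-]  : ∀ {x} → Last (x ∷ []) x
    _∷_ : ∀ {y xs} x → Last xs y → Last (x ∷ xs) y

  lastOf : X → List X → X
  lastOf x []       = x
  lastOf x (y ∷ ys) = lastOf y ys

  Last-lastOf : ∀ x xs → Last (x ∷ xs) (lastOf x xs)
  Last-lastOf x []       = [-]
  Last-lastOf x (y ∷ ys) = x ∷ Last-lastOf y ys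

  Last-functional : ∀ {xs a b} → Last xs a → Last xs b → a ≡ b
  Last-functional [-]      [-]      = refl
  Last-functional [-]      (_ ∷ ())
  Last-functional (_ ∷ ()) [-]
  Last-functional (_ ∷ p) (_ ∷ q) = Last-functional p q

  Last-++ : ∀ xs {ys l} → Last ys l → Last (xs ++ ys) l
  Last-++ []       p = p
  Last-++ (x ∷ xs) p = x ∷ Last-++ xs p

  Last⇒∈ : ∀ {xs l} → Last xs l → l ∈ˡ xs
  Last⇒∈ [-]     = here refl
  Last⇒∈ (_ ∷ p) = there (Last⇒∈ p)

  Last-ʳ++ : ∀ zs {acc l} → Last acc l → Last (zs ʳ++ acc) l
  Last-ʳ++ []       p = p
  Last-ʳ++ (z ∷ zs) p = Last-ʳ++ zs (z ∷ p)

  ʳ++-head : ∀ z zs acc {h} → Last (z ∷ zs) h → Σ (List X) λ r → zs ʳ++ (z ∷ acc) ≡ h ∷ r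
  ʳ++-head z []        acc [-]      = acc , refl
  ʳ++-head z []        acc (_ ∷ ())
  ʳ++-head z (z′ ∷ zs) acc (_ ∷ p)  = ʳ++-head z′ zs (z ∷ acc) p

  ʳ++-↭ : ∀ (zs acc : List X) → zs ʳ++ acc ↭ zs ++ acc
  ʳ++-↭ zs acc = ↭-trans (↭-reflexive (ʳ++-defn zs)) (++⁺ʳ acc (↭-reverse zs))

  ∷-++-head : ∀ {h r u t} s → h ∷ r ≡ s ++ u ∷ t → Σ (List X) λ q → s ++ [ u ] ≡ h ∷ q
  ∷-++-head []       refl = [] , refl
  ∷-++-head (s ∷ ss) refl = ss ++ [ _ ] , refl

  module _ (R : X → X → Set) where

    Linked-join : ∀ {xs a b ys} → Linked R xs → Last xs a → R a b → Linked R (b ∷ ys) →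
                  Linked R (xs ++ b ∷ ys)
    Linked-join [-]       [-]      r l = r ∷ l
    Linked-join [-]       (_ ∷ ()) r l
    Linked-join (x ∷ lxs) (_ ∷ p)  r l = x ∷ Linked-join lxs p r l

    Linked-++⁻ˡ : ∀ xs {ys} → Linked R (xs ++ ys) → Linked R xs
    Linked-++⁻ˡ []           l       = []
    Linked-++⁻ˡ (x ∷ [])     l       = [-]
    Linked-++⁻ˡ (x ∷ y ∷ xs) (r ∷ l) = r ∷ Linked-++⁻ˡ (y ∷ xs) l

    Linked-++⁻ʳ : ∀ xs {ys} → Linked R (xs ++ ys) → Linked R ys
    Linked-++⁻ʳ []       l = l
    Linked-++⁻ʳ (x ∷ xs) l = Linked-++⁻ʳ xs (Linked.tail l)

    Linked-ʳ++ : (∀ {a b} → R a b → R b a) →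
                 ∀ zs z acc → Linked R (z ∷ zs) → Linked R (z ∷ acc) → Linked R (zs ʳ++ (z ∷ acc))
    Linked-ʳ++ R-sym []        z acc _       l = l
    Linked-ʳ++ R-sym (z′ ∷ zs) z acc (r ∷ l) m = Linked-ʳ++ R-sym zs z′ (z ∷ acc) l (R-sym r ∷ m)

    cycle⇒path-to : ∀ h r {l} → Linked R (h ∷ r) → Last (h ∷ r) l → R l h → ∀ {u} → u ∈ˡ h ∷ r →
                    Σ (List X) λ ps → Linked R (ps ++ [ u ]) × (ps ++ [ u ] ↭ h ∷ r)
    cycle⇒path-to h r {l} lk la lh {u} u∈ with ∈-∃++ u∈
    ... | s , [] , e = s , subst (Linked R) e lk , ↭-reflexive (sym e)
    ... | s , t₀ ∷ t , e = (t₀ ∷ t) ++ s , linked , perm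
      where
      lk′ : Linked R ((s ++ [ u ]) ++ t₀ ∷ t)
      lk′ = subst (Linked R) (trans e (sym (++-assoc s [ u ] (t₀ ∷ t)))) lk
      t-last : Last (t₀ ∷ t) l
      t-last = subst (Last (t₀ ∷ t))
        (Last-functional (subst (λ z → Last z (lastOf t₀ t)) (sym e)
                                (subst (λ z → Last z (lastOf t₀ t)) (++-assoc s [ u ] (t₀ ∷ t))
                                       (Last-++ (s ++ [ u ]) (Last-lastOf t₀ t))))
                         la)
        (Last-lastOf t₀ t)
      su-head = ∷-++-head s e
      linked : Linked R (((t₀ ∷ t) ++ s) ++ [ u ])
      linked = subst (Linked R) (sym (++-assoc (t₀ ∷ t) s [ u ]))
        (subst (λ z → Linked R ((t₀ ∷ t) ++ z)) (sym (proj₂ su-head))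
          (Linked-join (Linked-++⁻ʳ (s ++ [ u ]) lk′) t-last lh
                       (subst (Linked R) (proj₂ su-head) (Linked-++⁻ˡ (s ++ [ u ]) lk′))))
      perm : ((t₀ ∷ t) ++ s) ++ [ u ] ↭ h ∷ r
      perm = ↭-trans (↭-reflexive (++-assoc (t₀ ∷ t) s [ u ]))
             (↭-trans (++-comm (t₀ ∷ t) (s ++ [ u ]))
             (↭-trans (↭-reflexive (++-assoc s [ u ] (t₀ ∷ t))) (↭-reflexive (sym e))))

Unique-resp-↭ : ∀ {X : Set} {xs ys : List X} → xs ↭ ys → Unique xs → Unique ys
Unique-resp-↭ {X} p = Permutationₛ.Unique-resp-↭ (setoid X) (↭⇒↭ₛ p)

∉⇒Unique-∷ : ∀ {X : Set} {x : X} {xs} → x ∉ˡ xs → Unique xs → Unique (x ∷ xs)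
∉⇒Unique-∷ {xs = xs} x∉ u = ¬Any⇒All¬ xs x∉ ∷ u

module _ {X : Set} where

  lookup-injective : ∀ {xs : List X} → Unique xs → ∀ {i j} → lookup xs i ≡ lookup xs j → i ≡ j
  lookup-injective (x≢ ∷ u) {fzero}  {fzero}  e = refl
  lookup-injective (x≢ ∷ u) {fzero}  {fsuc j} e = contradiction e (All.lookup x≢ (∈-lookup j))
  lookup-injective (x≢ ∷ u) {fsuc i} {fzero}  e = contradiction (sym e) (All.lookup x≢ (∈-lookup i))
  lookup-injective (x≢ ∷ u) {fsuc i} {fsuc j} e = cong fsuc (lookup-injective u e)

  Linked-lookup : ∀ {R : X → X → Set} {x xs} → Linked R (x ∷ xs) →
                  ∀ i → R (lookup (x ∷ xs) (inject₁ i)) (lookup (x ∷ xs) (fsuc i))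
  Linked-lookup (r ∷ l) fzero    = r
  Linked-lookup (r ∷ l) (fsuc i) = Linked-lookup l i

  countᵇ : (X → Bool) → List X → ℕ
  countᵇ f []       = 0
  countᵇ f (x ∷ xs) = 𝟙 (f x) + countᵇ f xs

  countᵇ-true : ∀ xs → countᵇ (λ _ → true) xs ≡ length xs
  countᵇ-true []       = refl
  countᵇ-true (x ∷ xs) = cong suc (countᵇ-true xs)

  record Crossing (f g : X → Bool) (L : List X) : Set where
    constructor crossing
    field
      pre post : List X
      a b      : X
      split    : L ≡ pre ++ a ∷ b ∷ post
      g-a      : g a ≡ true
      f-b      : f b ≡ true

  Crossing-∷ : ∀ {f g L} x → Crossing f g L → Crossing f g (x ∷ L)
  Crossing-∷ x (crossing pre post a b split g-a f-b) = crossing (x ∷ pre) post a b (cong (x ∷_) split) g-a f-b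

  crossing-pair : ∀ (f g : X → Bool) x xs → g (lastOf x xs) ≡ false →
                  length xs < countᵇ f xs + countᵇ g (x ∷ xs) → Crossing f g (x ∷ xs)
  crossing-pair f g x []       g-last h rewrite g-last with h
  ... | ()
  crossing-pair f g x (y ∷ ys) g-last h with g x in gx | f y in fy
  ... | true  | true  = crossing [] ys x y refl gx fy
  ... | true  | false = Crossing-∷ x (crossing-pair f g y ys g-last
                          (≤-pred (subst (suc (length ys) <_) (+-suc (countᵇ f ys) (countᵇ g (y ∷ ys))) h)))
  ... | false | true  = Crossing-∷ x (crossing-pair f g y ys g-last (≤-pred h))
  ... | false | false = Crossing-∷ x (crossing-pair f g y ys g-last (≤-trans (n≤1+n _) h))

countFin≤countᵇ : ∀ {n} (P : VertexSet n) (Q : Fin n → Bool) L →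
                  (∀ z → P z ≡ true → z ∈ˡ L × Q z ≡ true) → countFin P ≤ countᵇ Q L
countFin≤countᵇ P Q []      h = ≤-reflexive (countFin-empty P λ z → ¬-not λ Pz → ∉[] (proj₁ (h z Pz)))
  where
  ∉[] : ∀ {z : Fin _} → z ∉ˡ []
  ∉[] ()
countFin≤countᵇ P Q (a ∷ L) h = begin
  countFin P                  ≡⟨ countFin-∖ P a ⟩
  𝟙 (P a) + countFin (P ∖ a)  ≤⟨ +-mono-≤ (𝟙-mono (proj₂ ∘ h a)) (countFin≤countᵇ (P ∖ a) Q L h′) ⟩
  𝟙 (Q a) + countᵇ Q L        ∎
  where
  open ≤-Reasoning
  h′ : ∀ z → (P ∖ a) z ≡ true → z ∈ˡ L × Q z ≡ true
  h′ z Pz with h z (∖-⊆ P a z Pz)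
  ... | here z≡a , Qz = contradiction z≡a (∖-≢ P a z Pz)
  ... | there z∈L , Qz = z∈L , Qz

module LongPath {n} (G : Graph n) (u : Fin n) (u-dominating : Dominating G u)
                (F : VertexSet n) (u∈F : F u ≡ true)
                (d : ℕ) (δ-F : ∀ v → F v ≡ true → d ≤ degOn G F v) where

  open import Data.List.Membership.DecPropositional (_≟ᶠ_ {n}) using (_∈?_)

  _~_ : Fin n → Fin n → Set
  a ~ b = adj G a b ≡ true

  ~-sym : ∀ {a b} → a ~ b → b ~ a
  ~-sym {a} {b} a~b = trans (adj-sym G b a) a~b

  InF : Fin n → Set
  InF v = F v ≡ true

  _∪_ : (Fin n → Set) → Fin n → Fin n → Set
  (P ∪ w) z = P z ⊎ z ≡ w

  record Path (P : Fin n → Set) (m : ℕ) : Set where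
    constructor path
    field
      vertices : List (Fin n)
      linked   : Linked _~_ vertices
      unique   : Unique vertices
      inside   : All P vertices
      size     : length vertices ≡ m

  Closed : Fin n → List (Fin n) → Set
  Closed v L = ∀ z → InF z → v ~ z → z ∈ˡ L

  closed-or-escapes : ∀ v L → Closed v L ⊎ Σ (Fin n) λ z → InF z × v ~ z × z ∉ˡ L
  closed-or-escapes v L with any? (λ z → (F z ≟ᵇ true) ×-dec (adj G v z ≟ᵇ true) ×-dec ¬? (z ∈? L))
  ... | yes escape = inj₂ escape
  ... | no ∄escape = inj₁ λ z Fz v~z → decidable-stable (z ∈? L) λ z∉L → ∄escape (z , Fz , v~z , z∉L)

  record SpanningCycle (L : List (Fin n)) : Set where
    constructor cycle
    field
      first   : Fin n
      others  : List (Fin n)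
      final   : Fin n
      linked  : Linked _~_ (first ∷ others)
      ends    : Last (first ∷ others) final
      closing : final ~ first
      spans   : first ∷ others ↭ L

  degree-on-closed-path : ∀ v L → InF v → Closed v L → d ≤ countᵇ (adj G v) L
  degree-on-closed-path v L Fv closed = ≤-trans (δ-F v Fv) (countFin≤countᵇ _ (adj G v) L λ z h →
    let v~z , Fz = ∧-split h in closed z Fz v~z , v~z)
    where
    ∧-split : ∀ {a b} → (a ∧ b) ≡ true → a ≡ true × b ≡ true
    ∧-split {true} {true} _ = refl , refl

  -- Dirac: both ends have at least d neighbours on the path, which has fewer than 2d consecutive pairs,
  -- so some pair a b has y ~ a and x ~ b, and x … a b … y closes into the cycle y … b x … a.
  closed-path⇒cycle : ∀ x xs → Linked _~_ (x ∷ xs) → All InF (x ∷ xs) → suc (length xs) ≤ 2 * d →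
                      Closed x (x ∷ xs) → Closed (lastOf x xs) (x ∷ xs) → SpanningCycle (x ∷ xs)
  closed-path⇒cycle x xs lk inF short closed-x closed-y =
    cycle h (proj₁ cyc≡h∷r) a (subst (Linked _~_) (proj₂ cyc≡h∷r) cyc-linked) cyc-ends (~-sym h~a) cyc-spans
    where
    y = lastOf x xs
    L = x ∷ xs
    x-degree : d ≤ countᵇ (adj G x) xs
    x-degree = subst (d ≤_) (cong (λ b → 𝟙 b + countᵇ (adj G x) xs) (adj-irrefl G x))
                     (degree-on-closed-path x L (All.lookup inF (here refl)) closed-x)
    y-degree : d ≤ countᵇ (adj G y) L
    y-degree = degree-on-closed-path y L (All.lookup inF (Last⇒∈ (Last-lastOf x xs))) closed-y
    open Crossing (crossing-pair (adj G x) (adj G y) x xs (adj-irrefl G y)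
      (≤-trans short (≤-trans (≤-reflexive (cong (d +_) (+-identityʳ d))) (+-mono-≤ x-degree y-degree))))
    PA = pre ++ [ a ]
    split′ : L ≡ PA ++ b ∷ post
    split′ = trans split (sym (++-assoc pre [ a ] (b ∷ post)))
    lk′ : Linked _~_ (PA ++ b ∷ post)
    lk′ = subst (Linked _~_) split′ lk
    PA-from-x = ∷-++-head pre split
    b∷PA-linked : Linked _~_ (b ∷ PA)
    b∷PA-linked = subst (λ z → Linked _~_ (b ∷ z)) (sym (proj₂ PA-from-x))
      (~-sym f-b ∷ subst (Linked _~_) (proj₂ PA-from-x) (Linked-++⁻ˡ _~_ PA lk′))
    cyc = post ʳ++ (b ∷ PA)
    cyc-linked : Linked _~_ cyc
    cyc-linked = Linked-ʳ++ _~_ ~-sym post b PA (Linked-++⁻ʳ _~_ PA lk′) b∷PA-linked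
    h = lastOf b post
    cyc≡h∷r = ʳ++-head b post PA (Last-lastOf b post)
    cyc-ends : Last (h ∷ proj₁ cyc≡h∷r) a
    cyc-ends = subst (λ z → Last z a) (proj₂ cyc≡h∷r) (Last-ʳ++ post (b ∷ Last-++ pre [-]))
    h~a : h ~ a
    h~a = subst (_~ a) (Last-functional (Last-lastOf x xs)
                         (subst (λ z → Last z h) (sym split′) (Last-++ PA (Last-lastOf b post)))) g-a
    cyc-spans : h ∷ proj₁ cyc≡h∷r ↭ L
    cyc-spans = ↭-trans (↭-reflexive (sym (proj₂ cyc≡h∷r))) (↭-trans (ʳ++-↭ post (b ∷ PA))
                (↭-trans (shift b post PA) (↭-trans (++-comm (b ∷ post) PA) (↭-reflexive (sym split′)))))

  cycle⇒longer-path : ∀ {L} → SpanningCycle L → Unique L → All InF L → u ∈ˡ L →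
                      ∀ w → w ∉ˡ L → Path (InF ∪ w) (suc (length L))
  cycle⇒longer-path {L} (cycle h r a lk ends closing spans) un inF u∈L w w∉L =
    path ((ps ++ [ u ]) ++ [ w ])
         (Linked-join _~_ ps-u-linked (Last-++ ps [-]) (u-dominating w w≢u) [-])
         (Unique-resp-↭ (↭-sym perm) (∉⇒Unique-∷ w∉L un))
         (All-resp-↭ (↭-sym perm) (inj₂ refl ∷ All.map inj₁ inF))
         (↭-length perm)
    where
    rotation = cycle⇒path-to _~_ h r lk ends closing (∈-resp-↭ (↭-sym spans) u∈L)
    ps = proj₁ rotation
    ps-u-linked = proj₁ (proj₂ rotation)
    w≢u : w ≢ u
    w≢u w≡u = w∉L (subst (_∈ˡ L) (sym w≡u) u∈L)
    perm : (ps ++ [ u ]) ++ [ w ] ↭ w ∷ L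
    perm = ↭-trans (++-comm (ps ++ [ u ]) [ w ]) (prep w (↭-trans (proj₂ (proj₂ rotation)) spans))

  -- Pósa: a path that cannot be extended at either end inside F spans a cycle through u;
  -- reopened at u, it continues to w along the edge u ~ w.
  extend : ∀ {m} (p : Path InF (suc m)) → suc m ≤ 2 * d → ∀ w → w ∉ˡ Path.vertices p →
           Path (InF ∪ w) (suc (suc m))
  extend (path (x ∷ xs) lk un inF refl) short w w∉
    with closed-or-escapes x (x ∷ xs) | closed-or-escapes (lastOf x xs) (x ∷ xs)
  ... | inj₂ (z , Fz , x~z , z∉) | _ =
    path (z ∷ x ∷ xs) (~-sym x~z ∷ lk) (∉⇒Unique-∷ z∉ un) (inj₁ Fz ∷ All.map inj₁ inF) refl
  ... | inj₁ _ | inj₂ (z , Fz , y~z , z∉) =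
    path ((x ∷ xs) ++ [ z ]) (Linked-join _~_ lk (Last-lastOf x xs) y~z [-])
         (Unique-resp-↭ (++-comm [ z ] (x ∷ xs)) (∉⇒Unique-∷ z∉ un))
         (All-++⁺ (All.map inj₁ inF) (inj₁ Fz ∷ []))
         (trans (length-++ (x ∷ xs)) (+-comm (suc (length xs)) 1))
  ... | inj₁ closed-x | inj₁ closed-y =
    cycle⇒longer-path (closed-path⇒cycle x xs lk inF short closed-x closed-y) un inF u∈L w w∉
    where
    y = lastOf x xs
    u∈L : u ∈ˡ x ∷ xs
    u∈L = decidable-stable (u ∈? (x ∷ xs)) λ u∉ →
      u∉ (closed-y u u∈F (~-sym (u-dominating y λ y≡u →
        u∉ (subst (_∈ˡ x ∷ xs) y≡u (Last⇒∈ (Last-lastOf x xs))))))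

  weaken : ∀ {P Q : Fin n → Set} {m} → (∀ {z} → P z → Q z) → Path P m → Path Q m
  weaken P⇒Q (path vs lk un inside size) = path vs lk un (All.map P⇒Q inside) size

  Path⇒ContainsPath : ∀ {P m} → Path P (suc m) → ContainsPath G (suc m)
  Path⇒ContainsPath (path (x ∷ xs) lk un _ refl) = lookup (x ∷ xs) , lookup-injective un , Linked-lookup lk

  module _ (F-large : 2 * d ≤ countFin F) (w₀ : Fin n) (w₀∉F : F w₀ ≡ false) where

    -- Once the path covers F, which has at least 2d vertices, its last step leaves F through w₀.
    grow : ∀ m → m ≤ 2 * d → Path InF (suc m) ⊎ Path (λ _ → ⊤) (suc (2 * d))
    grow zero    _ = inj₁ (path [ u ] [-] (∉⇒Unique-∷ (λ ()) []) (u∈F ∷ []) refl)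
    grow (suc m) short with grow m (≤-trans (n≤1+n m) short)
    ... | inj₂ long = inj₂ long
    ... | inj₁ p with any? (λ w → (F w ≟ᵇ true) ×-dec ¬? (w ∈? Path.vertices p))
    ...   | yes (w , Fw , w∉) = inj₁ (weaken (λ { (inj₁ Fz) → Fz ; (inj₂ refl) → Fw }) (extend p short w w∉))
    ...   | no ∄w = inj₂ (subst (Path (λ _ → ⊤) ∘ suc) p-has-F (weaken (λ _ → tt) (extend p short w₀ w₀∉p)))
      where
      open Path p
      F⊆p : ∀ z → F z ≡ true → z ∈ˡ vertices × true ≡ true
      F⊆p z Fz = decidable-stable (z ∈? vertices) (λ z∉ → ∄w (z , Fz , z∉)) , refl
      p-has-F : suc m ≡ 2 * d
      p-has-F = ≤-antisym short (≤-trans F-large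
        (subst (countFin F ≤_) (trans (countᵇ-true vertices) size) (countFin≤countᵇ F _ vertices F⊆p)))
      w₀∉p : w₀ ∉ˡ vertices
      w₀∉p w₀∈ = true≢false (trans (sym (All.lookup inside w₀∈)) w₀∉F)

    long-path : Path (λ _ → ⊤) (suc (2 * d))
    long-path with grow (2 * d) ≤-refl
    ... | inj₁ p    = weaken (λ _ → tt) p
    ... | inj₂ long = long

∣tabulate∣≡countFin : ∀ {n} (T : VertexSet n) → ∣ tabulate T ∣ ≡ countFin T
∣tabulate∣≡countFin {zero}  T = refl
∣tabulate∣≡countFin {suc n} T with T fzero
... | true  = cong suc (∣tabulate∣≡countFin (T ∘ fsuc))
... | false = ∣tabulate∣≡countFin (T ∘ fsuc)

∈-tabulate : ∀ {n} {T : VertexSet n} {v} → T v ≡ true → v ∈ tabulate T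
∈-tabulate {T = T} {v} Tv = lookup⇒[]= v (tabulate T) (trans (lookup∘tabulate T v) Tv)

∈-tabulate⁻ : ∀ {n} {T : VertexSet n} {v} → v ∈ tabulate T → T v ≡ true
∈-tabulate⁻ {T = T} {v} v∈ = trans (sym (lookup∘tabulate T v)) ([]=⇒lookup v∈)

degIn-tabulate : ∀ {n} (G : Graph n) T v → degIn G (tabulate T) v ≡ degOn G T v
degIn-tabulate G T v = countFin-cong λ w → cong (adj G v w ∧_) (lookup∘tabulate T w)

2≤k∧7k²≤n⇒k<n∸k² : ∀ k n → 2 ≤ k → 7 * (k * k) ≤ n → suc k ≤ n ∸ k * k
2≤k∧7k²≤n⇒k<n∸k² k@(suc j) n 2≤k 7k²≤n = begin
  suc k                       ≤⟨ n≤1+n (suc k) ⟩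
  2 + k                       ≤⟨ +-mono-≤ 2≤k k≤k² ⟩
  k + k * k                   ≤⟨ +-monoˡ-≤ (k * k) k≤k² ⟩
  k * k + k * k               ≤⟨ m≤m+n (k * k + k * k) (4 * (k * k)) ⟩
  k * k + k * k + 4 * (k * k) ≡⟨ seven∸one (k * k) ⟩
  7 * (k * k) ∸ k * k         ≤⟨ ∸-monoˡ-≤ (k * k) 7k²≤n ⟩
  n ∸ k * k                   ∎
  where
  open ≤-Reasoning
  k≤k² : k ≤ k * k
  k≤k² = m≤m*n k k
  seven : ∀ x → 7 * x ≡ (x + x + 4 * x) + x
  seven = solve-∀
  seven∸one : ∀ x → x + x + 4 * x ≡ 7 * x ∸ x
  seven∸one x = sym (trans (cong (_∸ x) (seven x)) (m+n∸n≡m _ x))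

-- With k = suc j and n = r + k² + 1: k(n − k) − j(k² + 1) = kr + 1.
edge-surplus : ∀ j r n e e₁ → n ≡ r + suc (suc j * suc j) → suc j * (n ∸ suc j) < e →
               e ≤ e₁ + j * suc (suc j * suc j) → suc j * r + 2 ≤ e₁
edge-surplus j r n e e₁ n≡ many-edges e≤ = +-cancelʳ-≤ (j * suc (k * k)) _ _ (begin
  (k * r + 2) + j * suc (k * k)    ≡⟨ surplus-identity j r ⟩
  suc (k * (r + suc (j * k)))      ≡⟨ cong (λ m → suc (k * m)) n∸k≡ ⟨
  suc (k * (n ∸ k))                ≤⟨ many-edges ⟩
  e                                ≤⟨ e≤ ⟩
  e₁ + j * suc (k * k)             ∎)
  where
  open ≤-Reasoning
  k = suc j
  surplus-identity : ∀ j r → (suc j * r + 2) + j * suc (suc j * suc j) ≡ suc (suc j * (r + suc (j * suc j)))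
  surplus-identity = solve-∀
  split-k : ∀ j r → r + suc (suc j * suc j) ≡ suc j + (r + suc (j * suc j))
  split-k = solve-∀
  n∸k≡ : n ∸ k ≡ r + suc (j * k)
  n∸k≡ = trans (cong (_∸ k) (trans n≡ (split-k j r))) (m+n∸m≡n k _)

edge-surplus-preserved : ∀ k f s r e₁ e → r ≡ f + s → k * r + 2 ≤ e₁ → e₁ ≤ e + k * s → k * f + 2 ≤ e
edge-surplus-preserved k f s r e₁ e r≡ surplus e₁≤ = +-cancelʳ-≤ (k * s) _ _ (begin
  k * f + 2 + k * s  ≡⟨ distrib k f s ⟩
  k * (f + s) + 2    ≡⟨ cong (λ m → k * m + 2) r≡ ⟨
  k * r + 2          ≤⟨ surplus ⟩
  e₁                 ≤⟨ e₁≤ ⟩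
  e + k * s          ∎)
  where
  open ≤-Reasoning
  distrib : ∀ k f s → k * f + 2 + k * s ≡ k * (f + s) + 2
  distrib = solve-∀

choose2≤k*f : ∀ k f → f ≤ suc (2 * k) → choose2 f ≤ k * f
choose2≤k*f k f f≤ = *-cancelʳ-≤ (choose2 f) (k * f) 2 (+-cancelʳ-≤ f _ _ (begin
  choose2 f * 2 + f  ≡⟨ choose2-double f ⟩
  f * f              ≤⟨ *-monoˡ-≤ f f≤ ⟩
  suc (2 * k) * f    ≡⟨ regroup k f ⟩
  k * f * 2 + f      ∎))
  where
  open ≤-Reasoning
  regroup : ∀ k f → suc (2 * k) * f ≡ k * f * 2 + f
  regroup = solve-∀

kf+2≤choose2⇒2[1+k]≤f : ∀ k f → k * f + 2 ≤ choose2 f → 2 * suc k ≤ f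
kf+2≤choose2⇒2[1+k]≤f k f dense with 2 * suc k ≤? f
... | yes large = large
... | no  small = contradiction (≤-trans dense (choose2≤k*f k f f≤)) (m+1+n≰m (k * f))
  where
  double-suc : ∀ k → 2 * suc k ≡ suc (suc (2 * k))
  double-suc = solve-∀
  f≤ : f ≤ suc (2 * k)
  f≤ = ≤-pred (subst (f <_) (double-suc k) (≰⇒> small))

module _ {n} (G : Graph n) (u : Fin n) (dom : Dominating G u) where

  V : VertexSet n
  V _ = true

  few-removed⇒subgraph : ∀ k → 2 ≤ k → 7 * (k * k) ≤ n → (P : Peeling G u (k ∸ 1) (suc (k * k)) V) →
    Peeling.removed P ≤ k * k →
    Σ (Subset n) (λ S → (n ∸ k * k ≤ ∣ S ∣) × (u ∈ S) × ((v : Fin n) → v ∈ S → k ≤ degIn G S v))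
  few-removed⇒subgraph k@(suc _) 2≤k 7k²≤n P few =
    tabulate core , |S|≥ , ∈-tabulate u∈core ,
    λ v v∈S → subst (k ≤_) (sym (degIn-tabulate G core v)) (Peeling-δ dom P (s≤s few) large v (∈-tabulate⁻ v∈S))
    where
    open Peeling P
    |core|≡ : countFin core ≡ n ∸ removed
    |core|≡ = sym (trans (cong (_∸ removed) (trans (sym (countFin-full V λ _ → refl)) countFin-T))
                         (m+n∸n≡m _ removed))
    |core|≥ : n ∸ k * k ≤ countFin core
    |core|≥ = ≤-trans (∸-monoʳ-≤ n few) (≤-reflexive (sym |core|≡))
    large : suc k ≤ countFin core
    large = ≤-trans (2≤k∧7k²≤n⇒k<n∸k² k n 2≤k 7k²≤n) |core|≥
    |S|≥ : n ∸ k * k ≤ ∣ tabulate core ∣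
    |S|≥ = subst (n ∸ k * k ≤_) (sym (∣tabulate∣≡countFin core)) |core|≥

  many-removed⇒path : ∀ j → suc j * (n ∸ suc j) < edges G →
    (P : Peeling G u j (suc (suc j * suc j)) V) → suc j * suc j < Peeling.removed P →
    ContainsPath G (suc (2 * suc (suc j)))
  many-removed⇒path j many-edges P many = Path⇒ContainsPath (long-path F-large w₀ w₀∉F)
    where
    k = suc j
    open Peeling P using (core; u∈core; countFin-T; edgesOn-T; removed≤fuel)
    exhausted : Peeling.removed P ≡ suc (k * k)
    exhausted = ≤-antisym removed≤fuel many
    r = countFin core
    n≡ : n ≡ r + suc (k * k)
    n≡ = trans (sym (countFin-full V λ _ → refl)) (trans countFin-T (cong (r +_) exhausted))
    r<n : r < n
    r<n = subst (r <_) (sym n≡) (m<m+n r z<s)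
    r-surplus : k * r + 2 ≤ edgesOn G core
    r-surplus = edge-surplus j r n (edges G) (edgesOn G core) n≡ many-edges
      (subst₂ (λ e s → e ≤ edgesOn G core + j * s) (sym (edges≡edgesOn-full G)) exhausted edgesOn-T)
    second = peel G u k n core u∈core
    module Q = Peeling second
    F = Q.core
    f = countFin F
    F-surplus : k * f + 2 ≤ edgesOn G F
    F-surplus = edge-surplus-preserved k f Q.removed r _ _ Q.countFin-T r-surplus Q.edgesOn-T
    F-large : 2 * suc k ≤ f
    F-large = kf+2≤choose2⇒2[1+k]≤f k f (≤-trans F-surplus (edgesOn≤choose2 G F))
    f<n : f < n
    f<n = ≤-<-trans (m≤m+n f Q.removed) (subst (_< n) Q.countFin-T r<n)
    double : ∀ k → suc (suc k) + k ≡ 2 * suc k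
    double = solve-∀
    δ-F : ∀ v → F v ≡ true → suc k ≤ degOn G F v
    δ-F = Peeling-δ dom second (≤-<-trans (m≤n+m Q.removed f) (subst (_< n) Q.countFin-T r<n))
                    (≤-trans (m≤m+n (suc (suc k)) k) (≤-trans (≤-reflexive (double k)) F-large))
    w₀ = proj₁ (countFin<n⇒∃-false F f<n)
    w₀∉F = proj₂ (countFin<n⇒∃-false F f<n)
    open LongPath G u dom F Q.u∈core (suc k) δ-F

lemma9 : (k n : ℕ) → 2 ≤ k → 7 * (k * k) ≤ n →
    (G : Graph n) →
    k * (n ∸ k) < edges G →
    Σ (Fin n) (λ v → deg G v ≤ k ∸ 1) →
    (u : Fin n) → deg G u ≡ n ∸ 1 →
    ¬ ContainsPath G (2 * k + 3) →
    Σ (Subset n) (λ S →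
    (n ∸ k * k ≤ ∣ S ∣) × (u ∈ S) × ((v : Fin n) → v ∈ S → k ≤ degIn G S v))
lemma9 k@(suc j) n 2≤k 7k²≤n G many-edges _ u deg-u no-path =
  case ≤-<-connex (Peeling.removed first) (k * k) of λ where
    (inj₁ few)  → few-removed⇒subgraph G u dom k 2≤k 7k²≤n first few
    (inj₂ many) → contradiction (subst (ContainsPath G) (path-size j)
                                       (many-removed⇒path G u dom j many-edges first many))
                                no-path
  where
  dom = deg≡n∸1⇒Dominating G u deg-u
  first = peel G u j (suc (k * k)) (λ _ → true) refl
  path-size : ∀ j → suc (2 * suc (suc j)) ≡ 2 * suc j + 3
  path-size = solve-∀
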